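{- Let $(X,\mathcal{B})$ be a resolvable $(v,b,r,k)$-IBD that has a unique resolution (i.e., exactly one partition of $\mathcal{B}$ into parallel classes). Then this resolution is PRP-free.
   Context: For positive integers $v,b,r,k$ with $2\le k<v$, a $(v,b,r,k)$-IBD is a pair $(X,\mathcal{B})$ where $|X|=v$ and $\mathcal{B}$ is a multiset of $b$ $k$-subsets (blocks) of $X$ such that every point lies in exactly $r$ blocks. If $k\mid v$, a parallel class is a set of $w=v/k$ pairwise disjoint blocks, and a resolution is a partition of $\mathcal{B}$ into $r$ parallel classes $\Pi_1,\dots,\Pi_r$. For an integer $1\le\alpha\le w-1$, two distinct parallel classes $\Pi_i,\Pi_j$ of the resolution satisfy the $\alpha$-partial replacement property ($\alpha$-PRP) if there exist two parallel classes $\Pi_i^*,\Pi_j^*$ consisting of blocks of $\mathcal{B}$ such that $\Pi_i^*\cup\Pi_j^*=\Pi_i\cup\Pi_j$ and $|\Pi_i^*\cap\Pi_i|=\alpha$. The resolution is $\alpha$-PRP-free if no two of its parallel classes satisfy $\alpha$-PRP, and PRP-free if it is $\alpha$-PRP-free for every integer $1\le\alpha\le w-1$. -}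

module Defs where

open import Data.Nat using (ℕ; _≤_; _<_; _*_; _∸_)
open import Data.Nat.Divisibility using (_∣_)
open import Data.Fin using (Fin; _≟_)
open import Data.Fin.Subset using (Subset; ⊥; _∩_; _∪_; ∣_∣; _∈_)
open import Data.Vec using (lookup; tabulate)
open import Data.Product using (Σ; _×_; _,_)
open import Relation.Nullary using (¬_; does)
open import Relation.Binary.PropositionalEquality using (_≡_; _≢_)
open import Function.Bundles using (_⇔_)

-- Points are Fin v.  The multiset of b blocks is an indexed family
-- B : Fin b → Subset v (repeated blocks = distinct indices, same subset).

IsIBD : (v b r k : ℕ) → (Fin b → Subset v) → Set
IsIBD v b r k B =
  ((i : Fin b) → ∣ B i ∣ ≡ k) ×
  ((x : Fin v) → ∣ tabulate (λ i → lookup (B i) x) ∣ ≡ r)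

IsParallelClass : {v b : ℕ} → ℕ → (Fin b → Subset v) → Subset b → Set
IsParallelClass {v} {b} w B P =
  (∣ P ∣ ≡ w) ×
  ((i j : Fin b) → i ∈ P → j ∈ P → i ≢ j → B i ∩ B j ≡ ⊥)

classOf : {b r : ℕ} → (Fin b → Fin r) → Fin r → Subset b
classOf ρ j = tabulate (λ i → does (ρ i ≟ j))

-- A resolution: a partition of the blocks into r parallel classes
-- Π_1, …, Π_r, encoded as the class-assignment map ρ.
IsResolution : {v b : ℕ} → (r w : ℕ) → (Fin b → Subset v) → (Fin b → Fin r) → Set
IsResolution r w B ρ = (j : Fin r) → IsParallelClass w B (classOf ρ j)

-- Two resolutions are the same partition of B (up to relabelling classes).
SamePartition : {b r : ℕ} → (Fin b → Fin r) → (Fin b → Fin r) → Set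
SamePartition {b} ρ σ = (i i' : Fin b) → (ρ i ≡ ρ i') ⇔ (σ i ≡ σ i')

SatisfiesPRP : {v b r : ℕ} → (w : ℕ) → (Fin b → Subset v) → (Fin b → Fin r) →
               ℕ → Fin r → Fin r → Set
SatisfiesPRP {v} {b} w B ρ α i j =
  Σ (Subset b) λ P* → Σ (Subset b) λ Q* →
    IsParallelClass w B P* × IsParallelClass w B Q* ×
    (P* ∪ Q* ≡ classOf ρ i ∪ classOf ρ j) ×
    (∣ P* ∩ classOf ρ i ∣ ≡ α)

IsPRPFreeα : {v b r : ℕ} → (w : ℕ) → (Fin b → Subset v) → (Fin b → Fin r) → ℕ → Set
IsPRPFreeα {r = r} w B ρ α = (i j : Fin r) → i ≢ j → ¬ SatisfiesPRP w B ρ α i j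

IsPRPFree : {v b r : ℕ} → (w : ℕ) → (Fin b → Subset v) → (Fin b → Fin r) → Set
IsPRPFree w B ρ = (α : ℕ) → 1 ≤ α → α ≤ w ∸ 1 → IsPRPFreeα w B ρ α

{-# OPTIONS --safe #-}
module Submission where

-- A PRP for classes Π_i, Π_j of a resolution ρ provides parallel classes
-- Π_i*, Π_j* with union Π_i ∪ Π_j; counting blocks shows they are disjoint, so
-- relabelling Π_i* as class i and Π_j* as class j gives another resolution σ.
-- Since 0 < α < w, Π_i contains a block of Π_i* and a block of Π_j*: they
-- share a class under ρ but not under σ, contradicting uniqueness.

open import Defs
open import Data.Nat using (ℕ; zero; suc; _+_; _*_; _≤_; _<_; _∸_; s≤s)
open import Data.Nat.Properties using (+-suc; +-cancelˡ-≡; +-identityʳ)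
open import Data.Fin using (Fin; _≟_)
open import Data.Fin.Subset
  using (Subset; _-_; inside; outside; _∈_; _∉_; _∩_; _∪_; ∣_∣; Empty; Nonempty)
open import Data.Fin.Subset.Properties
  using (_∈?_; x∈p∩q⁺; x∈p∩q⁻; x∈p∪q⁺; x∈p∪q⁻; ⊆-antisym; Empty-unique; nonempty?;
         ∣⊥∣≡0; x∈p⇒∣p-x∣<∣p∣)
open import Data.Vec using (_∷_; []; here; there)
open import Data.Vec.Properties using (lookup⇒[]=; []=⇒lookup; lookup∘tabulate; tabulate-cong)
open import Data.Product using (Σ; ∃-syntax; _×_; _,_; proj₁; proj₂)
open import Data.Sum using (_⊎_; inj₁; inj₂)
import Data.Sum as Sum
open import Function.Bundles using (_⇔_; mk⇔; Equivalence)
open import Relation.Nullary using (¬_; yes; no; contradiction)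
open import Relation.Nullary.Decidable using (dec-true; does-⇔)
open import Relation.Binary.PropositionalEquality
  using (_≡_; _≢_; refl; sym; trans; cong; cong₂; subst; subst₂; module ≡-Reasoning)

private
  variable
    n v b r w α : ℕ

∣p∪q∣+∣p∩q∣≡∣p∣+∣q∣ : (p q : Subset n) → ∣ p ∪ q ∣ + ∣ p ∩ q ∣ ≡ ∣ p ∣ + ∣ q ∣
∣p∪q∣+∣p∩q∣≡∣p∣+∣q∣ []            []            = refl
∣p∪q∣+∣p∩q∣≡∣p∣+∣q∣ (inside ∷ p)  (inside ∷ q)  = cong suc (begin
  ∣ p ∪ q ∣ + suc ∣ p ∩ q ∣  ≡⟨ +-suc ∣ p ∪ q ∣ ∣ p ∩ q ∣ ⟩
  suc (∣ p ∪ q ∣ + ∣ p ∩ q ∣) ≡⟨ cong suc (∣p∪q∣+∣p∩q∣≡∣p∣+∣q∣ p q) ⟩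
  suc (∣ p ∣ + ∣ q ∣)         ≡⟨ +-suc ∣ p ∣ ∣ q ∣ ⟨
  ∣ p ∣ + suc ∣ q ∣          ∎)
  where open ≡-Reasoning
∣p∪q∣+∣p∩q∣≡∣p∣+∣q∣ (inside ∷ p)  (outside ∷ q) = cong suc (∣p∪q∣+∣p∩q∣≡∣p∣+∣q∣ p q)
∣p∪q∣+∣p∩q∣≡∣p∣+∣q∣ (outside ∷ p) (inside ∷ q)  =
  trans (cong suc (∣p∪q∣+∣p∩q∣≡∣p∣+∣q∣ p q)) (sym (+-suc ∣ p ∣ ∣ q ∣))
∣p∪q∣+∣p∩q∣≡∣p∣+∣q∣ (outside ∷ p) (outside ∷ q) = ∣p∪q∣+∣p∩q∣≡∣p∣+∣q∣ p q

∣p∣≡0⇒Empty : {p : Subset n} → ∣ p ∣ ≡ 0 → Empty p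
∣p∣≡0⇒Empty {p = p} ∣p∣≡0 (x , x∈p) with () ← subst (∣ p - x ∣ <_) ∣p∣≡0 (x∈p⇒∣p-x∣<∣p∣ x∈p)

Empty⇒∣p∣≡0 : {p : Subset n} → Empty p → ∣ p ∣ ≡ 0
Empty⇒∣p∣≡0 {n} p-empty = trans (cong ∣_∣ (Empty-unique p-empty)) (∣⊥∣≡0 n)

0<∣p∣⇒Nonempty : (p : Subset n) → 0 < ∣ p ∣ → Nonempty p
0<∣p∣⇒Nonempty p 0<∣p∣ with nonempty? p
... | yes ne = ne
... | no  ¬ne with () ← subst (0 <_) (Empty⇒∣p∣≡0 ¬ne) 0<∣p∣

there-∈q∉p : ∀ {s t} {p q : Subset n} → ∃[ x ] x ∈ q × x ∉ p → ∃[ x ] x ∈ t ∷ q × x ∉ s ∷ p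
there-∈q∉p (_ , x∈q , x∉p) = _ , there x∈q , λ { (there x∈p) → x∉p x∈p }

∣p∩q∣<∣q∣⇒∃∈q∉p : (p q : Subset n) → ∣ p ∩ q ∣ < ∣ q ∣ → ∃[ x ] x ∈ q × x ∉ p
∣p∩q∣<∣q∣⇒∃∈q∉p (outside ∷ p) (inside ∷ q)  _        = _ , here , λ ()
∣p∩q∣<∣q∣⇒∃∈q∉p (inside ∷ p)  (inside ∷ q)  (s≤s lt) = there-∈q∉p (∣p∩q∣<∣q∣⇒∃∈q∉p p q lt)
∣p∩q∣<∣q∣⇒∃∈q∉p (inside ∷ p)  (outside ∷ q) lt       = there-∈q∉p (∣p∩q∣<∣q∣⇒∃∈q∉p p q lt)
∣p∩q∣<∣q∣⇒∃∈q∉p (outside ∷ p) (outside ∷ q) lt       = there-∈q∉p (∣p∩q∣<∣q∣⇒∃∈q∉p p q lt)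

Empty-∩⇒∣p∪q∣≡∣p∣+∣q∣ : (p q : Subset n) → Empty (p ∩ q) → ∣ p ∪ q ∣ ≡ ∣ p ∣ + ∣ q ∣
Empty-∩⇒∣p∪q∣≡∣p∣+∣q∣ p q p∩q-empty = begin
  ∣ p ∪ q ∣               ≡⟨ +-identityʳ ∣ p ∪ q ∣ ⟨
  ∣ p ∪ q ∣ + 0           ≡⟨ cong (∣ p ∪ q ∣ +_) (Empty⇒∣p∣≡0 p∩q-empty) ⟨
  ∣ p ∪ q ∣ + ∣ p ∩ q ∣    ≡⟨ ∣p∪q∣+∣p∩q∣≡∣p∣+∣q∣ p q ⟩
  ∣ p ∣ + ∣ q ∣            ∎
  where open ≡-Reasoning

∣p∪q∣≡∣p∣+∣q∣⇒Empty-∩ : (p q : Subset n) → ∣ p ∪ q ∣ ≡ ∣ p ∣ + ∣ q ∣ → Empty (p ∩ q)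
∣p∪q∣≡∣p∣+∣q∣⇒Empty-∩ p q ∣p∪q∣≡ = ∣p∣≡0⇒Empty (+-cancelˡ-≡ ∣ p ∪ q ∣ ∣ p ∩ q ∣ 0 (begin
  ∣ p ∪ q ∣ + ∣ p ∩ q ∣    ≡⟨ ∣p∪q∣+∣p∩q∣≡∣p∣+∣q∣ p q ⟩
  ∣ p ∣ + ∣ q ∣            ≡⟨ ∣p∪q∣≡ ⟨
  ∣ p ∪ q ∣               ≡⟨ +-identityʳ ∣ p ∪ q ∣ ⟨
  ∣ p ∪ q ∣ + 0           ∎))
  where open ≡-Reasoning

∈-classOf⁺ : (ρ : Fin b → Fin r) {j : Fin r} {x : Fin b} → ρ x ≡ j → x ∈ classOf ρ j
∈-classOf⁺ ρ {j} {x} ρx≡j =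
  lookup⇒[]= x _ (trans (lookup∘tabulate _ x) (dec-true (ρ x ≟ j) ρx≡j))

∈-classOf⁻ : (ρ : Fin b → Fin r) {j : Fin r} {x : Fin b} → x ∈ classOf ρ j → ρ x ≡ j
∈-classOf⁻ ρ {j} {x} x∈Πj
  with ρ x ≟ j | trans (sym (lookup∘tabulate _ x)) ([]=⇒lookup x∈Πj)
... | yes ρx≡j | _ = ρx≡j

classOf-disjoint : (ρ : Fin b → Fin r) {i j : Fin r} → i ≢ j → Empty (classOf ρ i ∩ classOf ρ j)
classOf-disjoint ρ {i} {j} i≢j (x , x∈Πi∩Πj) with x∈p∩q⁻ (classOf ρ i) (classOf ρ j) x∈Πi∩Πj
... | x∈Πi , x∈Πj = i≢j (trans (sym (∈-classOf⁻ ρ x∈Πi)) (∈-classOf⁻ ρ x∈Πj))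

classOf-≡ : {σ : Fin b → Fin r} {j : Fin r} {p : Subset b} →
            (∀ x → σ x ≡ j ⇔ x ∈ p) → classOf σ j ≡ p
classOf-≡ {σ = σ} σx≡j⇔x∈p =
  ⊆-antisym (λ x∈Πj → Equivalence.to (σx≡j⇔x∈p _) (∈-classOf⁻ σ x∈Πj))
            (λ x∈p  → ∈-classOf⁺ σ (Equivalence.from (σx≡j⇔x∈p _) x∈p))

classOf-cong : {σ ρ : Fin b → Fin r} {m : Fin r} →
               (∀ x → σ x ≡ m ⇔ ρ x ≡ m) → classOf σ m ≡ classOf ρ m
classOf-cong {σ = σ} {ρ} {m} σx≡m⇔ρx≡m =
  tabulate-cong (λ x → does-⇔ (σx≡m⇔ρx≡m x) (σ x ≟ m) (ρ x ≟ m))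

exchange : (Fin b → Fin r) → Fin r → Subset b → Fin r → Subset b → Fin b → Fin r
exchange ρ i P j Q x with x ∈? P | x ∈? Q
... | yes _ | _     = i
... | no _  | yes _ = j
... | no _  | no _  = ρ x

module Exchange (ρ : Fin b → Fin r) {i j : Fin r} (i≢j : i ≢ j) {P Q : Subset b}
                (P∪Q≡Πi∪Πj : P ∪ Q ≡ classOf ρ i ∪ classOf ρ j) (P∩Q-empty : Empty (P ∩ Q))
                where

  σ : Fin b → Fin r
  σ = exchange ρ i P j Q

  ∈P∪Q⇒ρ∈ij : ∀ {x} → x ∈ P ⊎ x ∈ Q → ρ x ≡ i ⊎ ρ x ≡ j
  ∈P∪Q⇒ρ∈ij {x} x∈P∪Q =
    Sum.map (∈-classOf⁻ ρ) (∈-classOf⁻ ρ)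
            (x∈p∪q⁻ (classOf ρ i) _ (subst (x ∈_) P∪Q≡Πi∪Πj (x∈p∪q⁺ x∈P∪Q)))

  ρ∈ij⇒∈P∪Q : ∀ {x} → ρ x ≡ i ⊎ ρ x ≡ j → x ∈ P ⊎ x ∈ Q
  ρ∈ij⇒∈P∪Q {x} ρx∈ij =
    x∈p∪q⁻ P Q (subst (x ∈_) (sym P∪Q≡Πi∪Πj)
                      (x∈p∪q⁺ (Sum.map (∈-classOf⁺ ρ) (∈-classOf⁺ ρ) ρx∈ij)))

  ∉P∪Q⇒ρ∉ij : ∀ {x} → x ∉ P → x ∉ Q → ¬ (ρ x ≡ i ⊎ ρ x ≡ j)
  ∉P∪Q⇒ρ∉ij x∉P x∉Q ρx∈ij = Sum.[ x∉P , x∉Q ] (ρ∈ij⇒∈P∪Q ρx∈ij)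

  ∈P∪Q⇒ρx≢m : ∀ {m x} → m ≢ i → m ≢ j → x ∈ P ⊎ x ∈ Q → ρ x ≢ m
  ∈P∪Q⇒ρx≢m m≢i m≢j x∈P∪Q ρx≡m =
    Sum.[ (λ ρx≡i → m≢i (trans (sym ρx≡m) ρx≡i)) , (λ ρx≡j → m≢j (trans (sym ρx≡m) ρx≡j)) ]
      (∈P∪Q⇒ρ∈ij x∈P∪Q)

  σx≡i⇔x∈P : ∀ x → σ x ≡ i ⇔ x ∈ P
  σx≡i⇔x∈P x with x ∈? P | x ∈? Q
  ... | yes x∈P | _     = mk⇔ (λ _ → x∈P) (λ _ → refl)
  ... | no x∉P  | yes _ =
    mk⇔ (λ j≡i → contradiction (sym j≡i) i≢j) (λ x∈P → contradiction x∈P x∉P)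
  ... | no x∉P  | no x∉Q =
    mk⇔ (λ ρx≡i → contradiction (inj₁ ρx≡i) (∉P∪Q⇒ρ∉ij x∉P x∉Q))
        (λ x∈P → contradiction x∈P x∉P)

  σx≡j⇔x∈Q : ∀ x → σ x ≡ j ⇔ x ∈ Q
  σx≡j⇔x∈Q x with x ∈? P | x ∈? Q
  ... | yes x∈P | _      =
    mk⇔ (λ i≡j → contradiction i≡j i≢j)
        (λ x∈Q → contradiction (x , x∈p∩q⁺ (x∈P , x∈Q)) P∩Q-empty)
  ... | no _    | yes x∈Q = mk⇔ (λ _ → x∈Q) (λ _ → refl)
  ... | no x∉P  | no x∉Q  =
    mk⇔ (λ ρx≡j → contradiction (inj₂ ρx≡j) (∉P∪Q⇒ρ∉ij x∉P x∉Q))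
        (λ x∈Q → contradiction x∈Q x∉Q)

  σx≡m⇔ρx≡m : ∀ {m} → m ≢ i → m ≢ j → ∀ x → σ x ≡ m ⇔ ρ x ≡ m
  σx≡m⇔ρx≡m {m} m≢i m≢j x with x ∈? P | x ∈? Q
  ... | yes x∈P | _      =
    mk⇔ (λ i≡m → contradiction (sym i≡m) m≢i)
        (λ ρx≡m → contradiction ρx≡m (∈P∪Q⇒ρx≢m m≢i m≢j (inj₁ x∈P)))
  ... | no _    | yes x∈Q =
    mk⇔ (λ j≡m → contradiction (sym j≡m) m≢j)
        (λ ρx≡m → contradiction ρx≡m (∈P∪Q⇒ρx≢m m≢i m≢j (inj₂ x∈Q)))
  ... | no _    | no _    = mk⇔ (λ σx≡m → σx≡m) (λ ρx≡m → ρx≡m)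

  σ-isResolution : {B : Fin b → Subset v} → IsResolution r w B ρ →
                   IsParallelClass w B P → IsParallelClass w B Q → IsResolution r w B σ
  σ-isResolution {B = B} res P-parallel Q-parallel m with m ≟ i | m ≟ j
  ... | yes refl | _ = subst (IsParallelClass _ B) (sym (classOf-≡ σx≡i⇔x∈P)) P-parallel
  ... | no _  | yes refl = subst (IsParallelClass _ B) (sym (classOf-≡ σx≡j⇔x∈Q)) Q-parallel
  ... | no m≢i | no m≢j =
    subst (IsParallelClass _ B) (sym (classOf-cong (σx≡m⇔ρx≡m m≢i m≢j))) (res m)

PRP⇒anotherResolution :
  {B : Fin b → Subset v} {ρ : Fin b → Fin r} {i j : Fin r} →
  IsResolution r w B ρ → i ≢ j → 0 < α → α < w → SatisfiesPRP w B ρ α i j →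
  Σ (Fin b → Fin r) λ σ → IsResolution r w B σ × ¬ SamePartition ρ σ
PRP⇒anotherResolution {w = w} {ρ = ρ} {i} {j} res i≢j 0<α α<w
  (P , Q , P-parallel@(∣P∣≡w , _) , Q-parallel@(∣Q∣≡w , _) , P∪Q≡Πi∪Πj , ∣P∩Πi∣≡α) =
  σ , σ-isResolution res P-parallel Q-parallel , separates
  where
  Πi Πj : Subset _
  Πi = classOf ρ i
  Πj = classOf ρ j

  P∩Q-empty : Empty (P ∩ Q)
  P∩Q-empty = ∣p∪q∣≡∣p∣+∣q∣⇒Empty-∩ P Q (begin
    ∣ P ∪ Q ∣      ≡⟨ cong ∣_∣ P∪Q≡Πi∪Πj ⟩
    ∣ Πi ∪ Πj ∣    ≡⟨ Empty-∩⇒∣p∪q∣≡∣p∣+∣q∣ Πi Πj (classOf-disjoint ρ i≢j) ⟩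
    ∣ Πi ∣ + ∣ Πj ∣ ≡⟨ cong₂ _+_ (proj₁ (res i)) (proj₁ (res j)) ⟩
    w + w         ≡⟨ cong₂ _+_ ∣P∣≡w ∣Q∣≡w ⟨
    ∣ P ∣ + ∣ Q ∣   ∎)
    where open ≡-Reasoning

  open Exchange ρ i≢j P∪Q≡Πi∪Πj P∩Q-empty

  separates : ¬ SamePartition ρ σ
  separates same with 0<∣p∣⇒Nonempty (P ∩ Πi) (subst (0 <_) (sym ∣P∩Πi∣≡α) 0<α)
                    | ∣p∩q∣<∣q∣⇒∃∈q∉p P Πi (subst₂ _<_ (sym ∣P∩Πi∣≡α) (sym (proj₁ (res i))) α<w)
  ... | x , x∈P∩Πi | y , y∈Πi , y∉P = i≢j (begin
    i    ≡⟨ Equivalence.from (σx≡i⇔x∈P x) x∈P ⟨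
    σ x  ≡⟨ Equivalence.to (same x y) (trans ρx≡i (sym ρy≡i)) ⟩
    σ y  ≡⟨ Equivalence.from (σx≡j⇔x∈Q y) y∈Q ⟩
    j    ∎)
    where
    open ≡-Reasoning
    x∈P : x ∈ P
    x∈P = proj₁ (x∈p∩q⁻ P Πi x∈P∩Πi)
    ρx≡i : ρ x ≡ i
    ρx≡i = ∈-classOf⁻ ρ (proj₂ (x∈p∩q⁻ P Πi x∈P∩Πi))
    ρy≡i : ρ y ≡ i
    ρy≡i = ∈-classOf⁻ ρ y∈Πi
    y∈Q : y ∈ Q
    y∈Q = Sum.[ (λ y∈P → contradiction y∈P y∉P) , (λ y∈Q → y∈Q) ] (ρ∈ij⇒∈P∪Q (inj₁ ρy≡i))

≤∸1⇒< : ∀ {m n} → 0 < m → m ≤ n ∸ 1 → m < n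
≤∸1⇒< {n = zero}  (s≤s _) ()
≤∸1⇒< {n = suc n} _       m≤n = s≤s m≤n

lemma4p1 : (v b r k w : ℕ) → 2 ≤ k → k < v → v ≡ w * k →
           (B : Fin b → Subset v) → IsIBD v b r k B →
           (ρ : Fin b → Fin r) → IsResolution r w B ρ →
           ((σ : Fin b → Fin r) → IsResolution r w B σ → SamePartition ρ σ) →
           IsPRPFree w B ρ
lemma4p1 _ _ _ _ _ _ _ _ _ _ ρ res unique α 0<α α≤w∸1 i j i≢j prp
  with σ , σ-resolution , ¬same ← PRP⇒anotherResolution res i≢j 0<α (≤∸1⇒< 0<α α≤w∸1) prp
  = ¬same (unique σ σ-resolution)
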